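{- Let $n$ be a positive integer and let $G$ be one of the graphs $P_{2n}$ (the path on $2n$ vertices), $C_{2n}$ (the cycle on $2n$ vertices, here with $n\ge 2$), or $K_{n,n}$ (the complete bipartite graph with both parts of size $n$). If $k$ is odd with $1\le k\le 2n-1$, then $\beta(F_k(G))=\binom{2n}{k}/2$.
   Context: For a simple finite graph $G$ of order $N$ and an integer $1\le k\le N-1$, the $k$-token graph $F_k(G)$ is the graph whose vertices are all $k$-element subsets of $V(G)$, two such subsets being adjacent iff their symmetric difference is an edge of $G$. $\beta$ denotes the independence number. -}

module Defs where

open import Data.Nat using (ℕ; zero; suc; _+_; _*_; _∸_; _<_; _≤_)
open import Data.Nat.Combinatorics using (_C_)
open import Data.Nat.DivMod using (_/_; _%_)
open import Data.Bool using (Bool; true; false; _xor_)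
open import Data.Fin using (Fin; toℕ)
open import Data.Fin.Subset using (Subset; ∣_∣; ⁅_⁆; _∪_)
open import Data.Vec using (zipWith)
open import Data.List using (List; length)
open import Data.List.Membership.Propositional using (_∈_)
open import Data.List.Relation.Unary.All using (All)
open import Data.List.Relation.Unary.Unique.Propositional using (Unique)
open import Data.Product using (Σ; _×_; ∃-syntax)
open import Data.Sum using (_⊎_)
open import Relation.Binary.PropositionalEquality using (_≡_)
open import Relation.Nullary using (¬_)

-- A simple graph on the vertex set Fin N, given by its adjacency relation.
-- (The concrete graphs below are symmetric and irreflexive.)
Graph : ℕ → Set₁
Graph N = Fin N → Fin N → Set

path : (N : ℕ) → Graph N
path N i j = (suc (toℕ i) ≡ toℕ j) ⊎ (suc (toℕ j) ≡ toℕ i)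

cycle : (N : ℕ) → Graph N
cycle zero () j
cycle (suc m) i j = (suc (toℕ i) % suc m ≡ toℕ j) ⊎ (suc (toℕ j) % suc m ≡ toℕ i)

completeBipartite : (n : ℕ) → Graph (n + n)
completeBipartite n i j = ((toℕ i < n) × ¬ (toℕ j < n)) ⊎ (¬ (toℕ i < n) × (toℕ j < n))

_△_ : ∀ {N} → Subset N → Subset N → Subset N
A △ B = zipWith _xor_ A B

TokenAdj : ∀ {N} → Graph N → Subset N → Subset N → Set
TokenAdj G A B = ∃[ u ] ∃[ v ] (G u v × (A △ B ≡ ⁅ u ⁆ ∪ ⁅ v ⁆))

IsIndependentTokenSet : ∀ {N} → Graph N → ℕ → List (Subset N) → Set
IsIndependentTokenSet G k S =
  Unique S × All (λ A → ∣ A ∣ ≡ k) S ×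
  (∀ {A B} → A ∈ S → B ∈ S → ¬ TokenAdj G A B)

IndependenceNumberTokenGraph : ∀ {N} → Graph N → ℕ → ℕ → Set
IndependenceNumberTokenGraph G k m =
  (∃[ S ] (IsIndependentTokenSet G k S × length S ≡ m)) ×
  (∀ S → IsIndependentTokenSet G k S → length S ≤ m)

-- Each of the three graphs is bipartite and has a perfect matching by edges: {2i, 2i+1} in
-- P_2n and C_2n, {i, n+i} in K_n,n. Swapping the first matched pair that a token set A meets
-- in exactly one vertex is a size-preserving involution, and such a pair exists when |A| is
-- odd; so it pairs each vertex of F_k(G) with a neighbour, and an independent set contains at
-- most half of the C(2n,k) vertices. Conversely, moving a token along an edge changes the
-- parity of the number of tokens on one colour class, so the token sets with an even number
-- there form an independent set, and the involution maps it onto its complement.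
module Submission where

open import Defs
open import Data.Nat using (ℕ; _+_; _*_; _∸_; _≤_)
open import Data.Nat.Combinatorics using (_C_)
open import Data.Nat.DivMod using (_/_; _%_)
open import Data.Product using (_×_)
open import Relation.Binary.PropositionalEquality using (_≡_)

open import Data.Nat.Base using (zero; suc; _<_; z≤n; s≤s; parity)
open import Data.Nat.Properties
  using (_<?_; <-irrefl; <-≤-trans; ≤-antisym; +-suc; *-comm; +-identityʳ; m≤m+n; m≤n⇒m<n∨m≡n; suc-injective)
open import Data.Nat.DivMod using (m*n/n≡m; /-monoˡ-≤; m<n⇒m%n≡m; n%n≡0)
open import Data.Nat.Combinatorics using (nCk+nC[k+1]≡[n+1]C[k+1])
open import Data.Parity.Base as ℙ using (Parity; 0ℙ; 1ℙ; _⁻¹)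
open import Data.Parity.Properties using (p≢p⁻¹; p+p≡0ℙ; +-homo-+; suc-homo-⁻¹; +-commutativeSemigroup)
import Data.Parity.Properties as ℙₚ
open import Algebra.Properties.CommutativeSemigroup +-commutativeSemigroup using (interchange; x∙yz≈y∙xz)
open import Data.Bool.Base using (_xor_; _∨_; if_then_else_)
open import Data.Bool.Properties using (xor-same)
open import Data.Fin.Base using (Fin; toℕ; zero; suc; _↑ˡ_; _↑ʳ_)
open import Data.Fin.Properties using (toℕ-↑ˡ; toℕ-↑ʳ; toℕ<n)
open import Data.Fin.Subset using (Subset; ∣_∣; ⁅_⁆; _∪_; ⊥; inside; outside)
open import Data.Fin.Subset.Properties using (∪-identityˡ; ∪-identityʳ)
open import Data.Vec.Base using ([]; _∷_; _++_; take; drop)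
open import Data.Vec.Properties using (∷-injectiveʳ; take++drop≡id; ++-injective; zipWith-++)
open import Data.List.Base using (List; []; _∷_; [_]; length; map; filter) renaming (_++_ to _++ₗ_)
open import Data.List.Properties using (length-++; length-map)
open import Data.List.Membership.Propositional using (_∈_)
open import Data.List.Membership.Propositional.Properties
  using (∈-∃++; ∈-++⁻; ∈-++⁺ˡ; ∈-++⁺ʳ; ∈-map⁺; ∈-map⁻; ∈-filter⁺; ∈-filter⁻)
open import Data.List.Relation.Binary.Subset.Propositional using (_⊆_)
open import Data.List.Relation.Unary.Any using (here; there)
open import Data.List.Relation.Unary.All as All using (All)
open import Data.List.Relation.Unary.Unique.Propositional using (Unique; []; _∷_)
import Data.List.Relation.Unary.Unique.Propositional.Properties as Unique
open import Data.Product using (∃-syntax; _,_; proj₁; proj₂; uncurry)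
import Data.Product as Product
open import Data.Sum using (inj₁; inj₂)
import Data.Sum as Sum
open import Data.Empty using (⊥-elim)
open import Relation.Nullary using (¬_; does)
open import Relation.Nullary.Decidable using (dec-true; dec-false)
open import Relation.Binary.PropositionalEquality
  using (refl; sym; trans; cong; cong₂; subst; subst₂; _≢_; module ≡-Reasoning)
open import Function using (_∘_)

Unique⇒length≤ : ∀ {A : Set} {xs ys : List A} → Unique xs → xs ⊆ ys → length xs ≤ length ys
Unique⇒length≤ [] _ = z≤n
Unique⇒length≤ {xs = x ∷ xs} (x∉xs ∷ unique) xs⊆ys with ∈-∃++ (xs⊆ys (here refl))
... | us , vs , refl = subst (suc (length xs) ≤_) length-us++x∷vs (s≤s (Unique⇒length≤ unique xs⊆us++vs))
  where
  xs⊆us++vs : xs ⊆ us ++ₗ vs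
  xs⊆us++vs y∈xs with ∈-++⁻ us (xs⊆ys (there y∈xs))
  ... | inj₁ y∈us = ∈-++⁺ˡ y∈us
  ... | inj₂ (here refl) = ⊥-elim (All.lookup x∉xs y∈xs refl)
  ... | inj₂ (there y∈vs) = ∈-++⁺ʳ us y∈vs
  length-us++x∷vs : suc (length (us ++ₗ vs)) ≡ length (us ++ₗ x ∷ vs)
  length-us++x∷vs = begin
    suc (length (us ++ₗ vs))        ≡⟨ cong suc (length-++ us) ⟩
    suc (length us + length vs)     ≡⟨ +-suc (length us) (length vs) ⟨
    length us + length (x ∷ vs)     ≡⟨ length-++ us ⟨
    length (us ++ₗ x ∷ vs)          ∎
    where open ≡-Reasoning

subsetsOfSize : ∀ N → ℕ → List (Subset N)
subsetsOfSize zero    zero    = [ [] ]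
subsetsOfSize zero    (suc k) = []
subsetsOfSize (suc N) zero    = map (outside ∷_) (subsetsOfSize N zero)
subsetsOfSize (suc N) (suc k) = map (inside ∷_) (subsetsOfSize N k) ++ₗ map (outside ∷_) (subsetsOfSize N (suc k))

∈-subsetsOfSize⁺ : ∀ {N k} {A : Subset N} → ∣ A ∣ ≡ k → A ∈ subsetsOfSize N k
∈-subsetsOfSize⁺ {A = A} refl = ∈-subsetsOfSize-∣∣ A
  where
  ∈-subsetsOfSize-∣∣ : ∀ {N} (A : Subset N) → A ∈ subsetsOfSize N ∣ A ∣
  ∈-subsetsOfSize-∣∣ [] = here refl
  ∈-subsetsOfSize-∣∣ (inside ∷ A) = ∈-++⁺ˡ (∈-map⁺ (inside ∷_) (∈-subsetsOfSize-∣∣ A))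
  ∈-subsetsOfSize-∣∣ {suc N} (outside ∷ A) with ∣ A ∣ | ∈-subsetsOfSize-∣∣ A
  ... | zero  | A∈ = ∈-map⁺ (outside ∷_) A∈
  ... | suc m | A∈ = ∈-++⁺ʳ (map (inside ∷_) (subsetsOfSize N m)) (∈-map⁺ (outside ∷_) A∈)

∈-subsetsOfSize⁻ : ∀ N k {A : Subset N} → A ∈ subsetsOfSize N k → ∣ A ∣ ≡ k
∈-subsetsOfSize⁻ zero zero (here refl) = refl
∈-subsetsOfSize⁻ (suc N) zero A∈ with ∈-map⁻ (outside ∷_) A∈
... | _ , B∈ , refl = ∈-subsetsOfSize⁻ N zero B∈
∈-subsetsOfSize⁻ (suc N) (suc k) A∈ with ∈-++⁻ (map (inside ∷_) (subsetsOfSize N k)) A∈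
... | inj₁ A∈ˡ with ∈-map⁻ (inside ∷_) A∈ˡ
...   | _ , B∈ , refl = cong suc (∈-subsetsOfSize⁻ N k B∈)
∈-subsetsOfSize⁻ (suc N) (suc k) A∈ | inj₂ A∈ʳ with ∈-map⁻ (outside ∷_) A∈ʳ
...   | _ , B∈ , refl = ∈-subsetsOfSize⁻ N (suc k) B∈

subsetsOfSize-unique : ∀ N k → Unique (subsetsOfSize N k)
subsetsOfSize-unique zero    zero    = All.[] ∷ []
subsetsOfSize-unique zero    (suc k) = []
subsetsOfSize-unique (suc N) zero    = Unique.map⁺ ∷-injectiveʳ (subsetsOfSize-unique N zero)
subsetsOfSize-unique (suc N) (suc k) =
  Unique.++⁺ (Unique.map⁺ ∷-injectiveʳ (subsetsOfSize-unique N k))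
             (Unique.map⁺ ∷-injectiveʳ (subsetsOfSize-unique N (suc k))) disjoint
  where
  disjoint : ∀ {A} → ¬ (A ∈ map (inside ∷_) (subsetsOfSize N k) ×
                        A ∈ map (outside ∷_) (subsetsOfSize N (suc k)))
  disjoint (A∈ˡ , A∈ʳ) with ∈-map⁻ (inside ∷_) A∈ˡ | ∈-map⁻ (outside ∷_) A∈ʳ
  ... | _ , _ , refl | _ , _ , ()

length-subsetsOfSize : ∀ N k → length (subsetsOfSize N k) ≡ N C k
length-subsetsOfSize zero    zero    = refl
length-subsetsOfSize zero    (suc k) = refl
length-subsetsOfSize (suc N) zero    =
  trans (length-map (outside ∷_) (subsetsOfSize N zero)) (length-subsetsOfSize N zero)
length-subsetsOfSize (suc N) (suc k) = begin
  length (map (inside ∷_) (subsetsOfSize N k) ++ₗ map (outside ∷_) (subsetsOfSize N (suc k)))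
    ≡⟨ length-++ (map (inside ∷_) (subsetsOfSize N k)) ⟩
  length (map (inside ∷_) (subsetsOfSize N k)) + length (map (outside ∷_) (subsetsOfSize N (suc k)))
    ≡⟨ cong₂ _+_ (length-map (inside ∷_) (subsetsOfSize N k))
                 (length-map (outside ∷_) (subsetsOfSize N (suc k))) ⟩
  length (subsetsOfSize N k) + length (subsetsOfSize N (suc k))
    ≡⟨ cong₂ _+_ (length-subsetsOfSize N k) (length-subsetsOfSize N (suc k)) ⟩
  N C k + N C suc k
    ≡⟨ nCk+nC[k+1]≡[n+1]C[k+1] N k ⟩
  suc N C suc k ∎
  where open ≡-Reasoning

ProperColouring : ∀ {N} → Graph N → (Fin N → Parity) → Set
ProperColouring G c = ∀ {u v} → G u v → c u ≢ c v

colourParity : ∀ {N} → (Fin N → Parity) → Subset N → Parity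
colourParity c []            = 0ℙ
colourParity c (outside ∷ A) = colourParity (c ∘ suc) A
colourParity c (inside ∷ A)  = c zero ℙ.+ colourParity (c ∘ suc) A

colourParity-⊥ : ∀ {N} (c : Fin N → Parity) → colourParity c ⊥ ≡ 0ℙ
colourParity-⊥ {zero}  c = refl
colourParity-⊥ {suc N} c = colourParity-⊥ (c ∘ suc)

colourParity-⁅⁆ : ∀ {N} (c : Fin N → Parity) (u : Fin N) → colourParity c ⁅ u ⁆ ≡ c u
colourParity-⁅⁆ c zero    = trans (cong (c zero ℙ.+_) (colourParity-⊥ (c ∘ suc))) (ℙₚ.+-identityʳ (c zero))
colourParity-⁅⁆ c (suc u) = colourParity-⁅⁆ (c ∘ suc) u

colourParity-⁅⁆∪⁅⁆ : ∀ {N} (c : Fin N → Parity) {u v : Fin N} → u ≢ v →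
                     colourParity c (⁅ u ⁆ ∪ ⁅ v ⁆) ≡ c u ℙ.+ c v
colourParity-⁅⁆∪⁅⁆ c {zero}  {zero}  u≢v = ⊥-elim (u≢v refl)
colourParity-⁅⁆∪⁅⁆ c {zero}  {suc v} u≢v =
  cong (c zero ℙ.+_) (trans (cong (colourParity (c ∘ suc)) (∪-identityˡ ⁅ v ⁆))
                            (colourParity-⁅⁆ (c ∘ suc) v))
colourParity-⁅⁆∪⁅⁆ c {suc u} {zero}  u≢v = trans
  (cong (c zero ℙ.+_) (trans (cong (colourParity (c ∘ suc)) (∪-identityʳ ⁅ u ⁆))
                             (colourParity-⁅⁆ (c ∘ suc) u)))
  (ℙₚ.+-comm (c zero) (c (suc u)))
colourParity-⁅⁆∪⁅⁆ c {suc u} {suc v} u≢v = colourParity-⁅⁆∪⁅⁆ (c ∘ suc) (u≢v ∘ cong suc)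

colourParity-△ : ∀ {N} (c : Fin N → Parity) (A B : Subset N) →
                 colourParity c (A △ B) ≡ colourParity c A ℙ.+ colourParity c B
colourParity-△ c [] [] = refl
colourParity-△ c (outside ∷ A) (outside ∷ B) = colourParity-△ (c ∘ suc) A B
colourParity-△ c (inside ∷ A) (outside ∷ B) =
  trans (cong (c zero ℙ.+_) (colourParity-△ (c ∘ suc) A B)) (sym (ℙₚ.+-assoc (c zero) _ _))
colourParity-△ c (outside ∷ A) (inside ∷ B) =
  trans (cong (c zero ℙ.+_) (colourParity-△ (c ∘ suc) A B))
        (x∙yz≈y∙xz (c zero) (colourParity (c ∘ suc) A) (colourParity (c ∘ suc) B))
colourParity-△ c (inside ∷ A) (inside ∷ B) = begin
  colourParity (c ∘ suc) (A △ B)                    ≡⟨ colourParity-△ (c ∘ suc) A B ⟩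
  a ℙ.+ b                                           ≡⟨ cong (ℙ._+ (a ℙ.+ b)) (p+p≡0ℙ (c zero)) ⟨
  (c zero ℙ.+ c zero) ℙ.+ (a ℙ.+ b)                 ≡⟨ interchange (c zero) (c zero) a b ⟩
  (c zero ℙ.+ a) ℙ.+ (c zero ℙ.+ b)                 ∎
  where
  open ≡-Reasoning
  a = colourParity (c ∘ suc) A
  b = colourParity (c ∘ suc) B

≢⇒+≡1ℙ : ∀ {p q : Parity} → p ≢ q → p ℙ.+ q ≡ 1ℙ
≢⇒+≡1ℙ {0ℙ} {0ℙ} p≢q = ⊥-elim (p≢q refl)
≢⇒+≡1ℙ {0ℙ} {1ℙ} _   = refl
≢⇒+≡1ℙ {1ℙ} {0ℙ} _   = refl
≢⇒+≡1ℙ {1ℙ} {1ℙ} p≢q = ⊥-elim (p≢q refl)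

colourParity-adjacent : ∀ {N} {G : Graph N} {c} → ProperColouring G c → ∀ {A B} →
                        TokenAdj G A B → colourParity c A ℙ.+ colourParity c B ≡ 1ℙ
colourParity-adjacent {c = c} proper {A} {B} (u , v , uv , A△B≡uv) = begin
  colourParity c A ℙ.+ colourParity c B  ≡⟨ colourParity-△ c A B ⟨
  colourParity c (A △ B)                 ≡⟨ cong (colourParity c) A△B≡uv ⟩
  colourParity c (⁅ u ⁆ ∪ ⁅ v ⁆)          ≡⟨ colourParity-⁅⁆∪⁅⁆ c (proper uv ∘ cong c) ⟩
  c u ℙ.+ c v                            ≡⟨ ≢⇒+≡1ℙ (proper uv) ⟩
  1ℙ                                     ∎
  where open ≡-Reasoning

m+m≡m*2 : ∀ m → m + m ≡ m * 2
m+m≡m*2 m = trans (cong (m +_) (sym (+-identityʳ m))) (*-comm 2 m)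

m+m≡n⇒n/2≡m : ∀ {m n} → m + m ≡ n → n / 2 ≡ m
m+m≡n⇒n/2≡m {m} refl = trans (cong (_/ 2) (m+m≡m*2 m)) (m*n/n≡m m 2)

m+m≤n⇒m≤n/2 : ∀ {m n} → m + m ≤ n → m ≤ n / 2
m+m≤n⇒m≤n/2 {m} m+m≤n = subst (_≤ _) (m+m≡n⇒n/2≡m refl) (/-monoˡ-≤ 2 m+m≤n)

record TokenSwitch {N} (G : Graph N) : Set where
  field
    switch            : Subset N → Subset N
    switch-involutive : ∀ A → switch (switch A) ≡ A
    ∣switch∣          : ∀ A → ∣ switch A ∣ ≡ ∣ A ∣
    switch-adjacent   : ∀ A → parity ∣ A ∣ ≡ 1ℙ → TokenAdj G A (switch A)

  switch-injective : ∀ {A B} → switch A ≡ switch B → A ≡ B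
  switch-injective {A} {B} eq = trans (sym (switch-involutive A)) (trans (cong switch eq) (switch-involutive B))

TokenSwitch-mono : ∀ {N} {G H : Graph N} → (∀ {u v} → G u v → H u v) → TokenSwitch G → TokenSwitch H
TokenSwitch-mono G⇒H σ = record
  { switch            = switch
  ; switch-involutive = switch-involutive
  ; ∣switch∣          = ∣switch∣
  ; switch-adjacent   = λ A odd → let u , v , uv , eq = switch-adjacent A odd in u , v , G⇒H uv , eq
  }
  where open TokenSwitch σ

length-++-map : ∀ {A : Set} (f : A → A) (xs : List A) → length (xs ++ₗ map f xs) ≡ length xs + length xs
length-++-map f xs = trans (length-++ xs) (cong (length xs +_) (length-map f xs))

module _ {N} {G : Graph N} (σ : TokenSwitch G) {k} (k-odd : parity k ≡ 1ℙ) where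
  open TokenSwitch σ

  switch-adjacentₖ : ∀ {A} → ∣ A ∣ ≡ k → TokenAdj G A (switch A)
  switch-adjacentₖ {A} ∣A∣≡k = switch-adjacent A (trans (cong parity ∣A∣≡k) k-odd)

  switch-∈-subsetsOfSize : ∀ {A} → A ∈ subsetsOfSize N k → switch A ∈ subsetsOfSize N k
  switch-∈-subsetsOfSize {A} A∈ = ∈-subsetsOfSize⁺ (trans (∣switch∣ A) (∈-subsetsOfSize⁻ N k A∈))

  independent-double-≤ : ∀ {S} → IsIndependentTokenSet G k S → length S + length S ≤ N C k
  independent-double-≤ {S} (unique , sizes , independent) = subst₂ _≤_
    (length-++-map switch S) (length-subsetsOfSize N k)
    (Unique⇒length≤ (Unique.++⁺ unique (Unique.map⁺ switch-injective unique) disjoint) S++σS⊆)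
    where
    disjoint : ∀ {A} → ¬ (A ∈ S × A ∈ map switch S)
    disjoint (A∈S , A∈σS) with ∈-map⁻ switch A∈σS
    ... | B , B∈S , refl = independent B∈S A∈S (switch-adjacentₖ (All.lookup sizes B∈S))
    S++σS⊆ : S ++ₗ map switch S ⊆ subsetsOfSize N k
    S++σS⊆ A∈ with ∈-++⁻ S A∈
    ... | inj₁ A∈S = ∈-subsetsOfSize⁺ (All.lookup sizes A∈S)
    ... | inj₂ A∈σS with ∈-map⁻ switch A∈σS
    ...   | B , B∈S , refl = switch-∈-subsetsOfSize (∈-subsetsOfSize⁺ (All.lookup sizes B∈S))

evenColourClass : ∀ {N} → (Fin N → Parity) → ℕ → List (Subset N)
evenColourClass {N} c k = filter (λ A → colourParity c A ℙₚ.≟ 0ℙ) (subsetsOfSize N k)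

module _ {N} {G : Graph N} {c} (proper : ProperColouring G c) where

  evenColourClass-independent : ∀ k → IsIndependentTokenSet G k (evenColourClass c k)
  evenColourClass-independent k =
    Unique.filter⁺ _ (subsetsOfSize-unique N k) ,
    All.tabulate (∈-subsetsOfSize⁻ N k ∘ proj₁ ∘ ∈-filter⁻ _) ,
    independent
    where
    even : ∀ {A} → A ∈ evenColourClass c k → colourParity c A ≡ 0ℙ
    even = proj₂ ∘ ∈-filter⁻ _ {xs = subsetsOfSize N k}
    independent : ∀ {A B} → A ∈ evenColourClass c k → B ∈ evenColourClass c k → ¬ TokenAdj G A B
    independent A∈ B∈ A~B with trans (sym (cong₂ ℙ._+_ (even A∈) (even B∈))) (colourParity-adjacent proper A~B)
    ... | ()

  module _ (σ : TokenSwitch G) {k} (k-odd : parity k ≡ 1ℙ) where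
    open TokenSwitch σ

    -- switch maps the odd colour class into the even one.
    evenColourClass-double-≥ : N C k ≤ length (evenColourClass c k) + length (evenColourClass c k)
    evenColourClass-double-≥ = subst₂ _≤_ (length-subsetsOfSize N k) (length-++-map switch E)
      (Unique⇒length≤ (subsetsOfSize-unique N k) ⊆E++σE)
      where
      E = evenColourClass c k
      ⊆E++σE : subsetsOfSize N k ⊆ E ++ₗ map switch E
      ⊆E++σE {A} A∈ with colourParity c A in A-parity
      ... | 0ℙ = ∈-++⁺ˡ (∈-filter⁺ _ A∈ A-parity)
      ... | 1ℙ = ∈-++⁺ʳ E (subst (_∈ map switch E) (switch-involutive A) (∈-map⁺ switch σA∈E))
        where
        σA-even : colourParity c (switch A) ≡ 0ℙ
        σA-even = ℙₚ.+-cancelˡ-≡ 1ℙ _ _ (trans (cong (ℙ._+ colourParity c (switch A)) (sym A-parity))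
          (colourParity-adjacent proper (switch-adjacentₖ σ k-odd {A} (∈-subsetsOfSize⁻ N k A∈))))
        σA∈E : switch A ∈ E
        σA∈E = ∈-filter⁺ _ (switch-∈-subsetsOfSize σ k-odd A∈) σA-even

    independenceNumber≡half : IndependenceNumberTokenGraph G k ((N C k) / 2)
    independenceNumber≡half =
      (evenColourClass c k , evenColourClass-independent k , sym (m+m≡n⇒n/2≡m double-E≡C)) ,
      λ S S-independent → m+m≤n⇒m≤n/2 (independent-double-≤ σ k-odd S-independent)
      where
      double-E≡C : length (evenColourClass c k) + length (evenColourClass c k) ≡ N C k
      double-E≡C =
        ≤-antisym (independent-double-≤ σ k-odd (evenColourClass-independent k)) evenColourClass-double-≥

△-self : ∀ {N} (A : Subset N) → A △ A ≡ ⊥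
△-self []            = refl
△-self (inside ∷ A)  = cong (outside ∷_) (△-self A)
△-self (outside ∷ A) = cong (outside ∷_) (△-self A)

parity[n+n]≡0ℙ : ∀ n → parity (n + n) ≡ 0ℙ
parity[n+n]≡0ℙ n = trans (+-homo-+ n n) (p+p≡0ℙ (parity n))

parity-suc-≢ : ∀ m → parity m ≢ parity (suc m)
parity-suc-≢ m eq = p≢p⁻¹ (parity (suc m)) (sym (trans (suc-homo-⁻¹ m) eq))

path-properColouring : ∀ N → ProperColouring (path N) (parity ∘ toℕ)
path-properColouring N {u} {v} (inj₁ u+1≡v) eq = parity-suc-≢ (toℕ u) (trans eq (cong parity (sym u+1≡v)))
path-properColouring N {u} {v} (inj₂ v+1≡u) eq = parity-suc-≢ (toℕ v) (trans (sym eq) (cong parity (sym v+1≡u)))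

pathSwitch : ∀ {N} → Subset N → Subset N
pathSwitch []                      = []
pathSwitch (a ∷ [])                = a ∷ []
pathSwitch (inside ∷ inside ∷ A)   = inside ∷ inside ∷ pathSwitch A
pathSwitch (outside ∷ outside ∷ A) = outside ∷ outside ∷ pathSwitch A
pathSwitch (inside ∷ outside ∷ A)  = outside ∷ inside ∷ A
pathSwitch (outside ∷ inside ∷ A)  = inside ∷ outside ∷ A

pathSwitch-involutive : ∀ {N} (A : Subset N) → pathSwitch (pathSwitch A) ≡ A
pathSwitch-involutive []                      = refl
pathSwitch-involutive (a ∷ [])                = refl
pathSwitch-involutive (inside ∷ inside ∷ A)   = cong (λ B → inside ∷ inside ∷ B) (pathSwitch-involutive A)
pathSwitch-involutive (outside ∷ outside ∷ A) = cong (λ B → outside ∷ outside ∷ B) (pathSwitch-involutive A)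
pathSwitch-involutive (inside ∷ outside ∷ A)  = refl
pathSwitch-involutive (outside ∷ inside ∷ A)  = refl

∣pathSwitch∣ : ∀ {N} (A : Subset N) → ∣ pathSwitch A ∣ ≡ ∣ A ∣
∣pathSwitch∣ []                      = refl
∣pathSwitch∣ (inside ∷ [])           = refl
∣pathSwitch∣ (outside ∷ [])          = refl
∣pathSwitch∣ (inside ∷ inside ∷ A)   = cong (2 +_) (∣pathSwitch∣ A)
∣pathSwitch∣ (outside ∷ outside ∷ A) = ∣pathSwitch∣ A
∣pathSwitch∣ (inside ∷ outside ∷ A)  = refl
∣pathSwitch∣ (outside ∷ inside ∷ A)  = refl

A△A≡⊥∪⊥ : ∀ {N} (A : Subset N) → A △ A ≡ ⊥ ∪ ⊥
A△A≡⊥∪⊥ A = trans (△-self A) (sym (∪-identityˡ ⊥))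

path-tokenAdj-∷∷ : ∀ {N} a {A B : Subset N} → TokenAdj (path N) A B →
                   TokenAdj (path (suc (suc N))) (a ∷ a ∷ A) (a ∷ a ∷ B)
path-tokenAdj-∷∷ a (u , v , uv , A△B≡uv) =
  suc (suc u) , suc (suc v) , Sum.map (cong (2 +_)) (cong (2 +_)) uv ,
  cong₂ (λ b C → b ∷ b ∷ C) (xor-same a) A△B≡uv

pathSwitch-adjacent : ∀ {N} → parity N ≡ 0ℙ → (A : Subset N) → parity ∣ A ∣ ≡ 1ℙ →
                      TokenAdj (path N) A (pathSwitch A)
pathSwitch-adjacent _  [] ()
pathSwitch-adjacent () (a ∷ [])
pathSwitch-adjacent N-even (inside ∷ inside ∷ A) A-odd =
  path-tokenAdj-∷∷ inside (pathSwitch-adjacent N-even A A-odd)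
pathSwitch-adjacent N-even (outside ∷ outside ∷ A) A-odd =
  path-tokenAdj-∷∷ outside (pathSwitch-adjacent N-even A A-odd)
pathSwitch-adjacent _ (inside ∷ outside ∷ A) _ =
  zero , suc zero , inj₁ refl , cong ((inside ∷_) ∘ (inside ∷_)) (A△A≡⊥∪⊥ A)
pathSwitch-adjacent _ (outside ∷ inside ∷ A) _ =
  zero , suc zero , inj₁ refl , cong ((inside ∷_) ∘ (inside ∷_)) (A△A≡⊥∪⊥ A)

path-tokenSwitch : ∀ {N} → parity N ≡ 0ℙ → TokenSwitch (path N)
path-tokenSwitch N-even = record
  { switch            = pathSwitch
  ; switch-involutive = pathSwitch-involutive
  ; ∣switch∣          = ∣pathSwitch∣
  ; switch-adjacent   = pathSwitch-adjacent N-even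
  }

path⇒cycle : ∀ {M} {u v : Fin (suc M)} → path (suc M) u v → cycle (suc M) u v
path⇒cycle {M} {u} {v} (inj₁ u+1≡v) =
  inj₁ (trans (m<n⇒m%n≡m (subst (_< suc M) (sym u+1≡v) (toℕ<n v))) u+1≡v)
path⇒cycle {M} {u} {v} (inj₂ v+1≡u) =
  inj₂ (trans (m<n⇒m%n≡m (subst (_< suc M) (sym v+1≡u) (toℕ<n u))) v+1≡u)

cycle-tokenSwitch : ∀ {M} → parity (suc M) ≡ 0ℙ → TokenSwitch (cycle (suc M))
cycle-tokenSwitch N-even = TokenSwitch-mono path⇒cycle (path-tokenSwitch N-even)

-- The only cycle edge that is not a path edge joins M to 0, and M is odd.
cyclic-successor-parity-≢ : ∀ {M} → parity (suc M) ≡ 0ℙ → {u v : Fin (suc M)} →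
                            suc (toℕ u) % suc M ≡ toℕ v → parity (toℕ u) ≢ parity (toℕ v)
cyclic-successor-parity-≢ {M} N-even {u} {v} u+1≡v with m≤n⇒m<n∨m≡n (toℕ<n u)
... | inj₁ u+1<N = path-properColouring (suc M) (inj₁ (trans (sym (m<n⇒m%n≡m u+1<N)) u+1≡v))
... | inj₂ u+1≡N = λ eq → 1ℙ≢0ℙ (begin
  1ℙ                  ≡⟨ cong _⁻¹ N-even ⟨
  parity (suc M) ⁻¹   ≡⟨ suc-homo-⁻¹ M ⟩
  parity M            ≡⟨ cong parity (suc-injective u+1≡N) ⟨
  parity (toℕ u)      ≡⟨ eq ⟩
  parity (toℕ v)      ≡⟨ cong parity v≡0 ⟩
  0ℙ                  ∎)
  where
  open ≡-Reasoning
  1ℙ≢0ℙ : 1ℙ ≢ 0ℙ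
  1ℙ≢0ℙ ()
  v≡0 : toℕ v ≡ 0
  v≡0 = trans (sym u+1≡v) (trans (cong (_% suc M) u+1≡N) (n%n≡0 (suc M)))

cycle-properColouring : ∀ {M} → parity (suc M) ≡ 0ℙ → ProperColouring (cycle (suc M)) (parity ∘ toℕ)
cycle-properColouring N-even (inj₁ u+1≡v)        = cyclic-successor-parity-≢ N-even u+1≡v
cycle-properColouring N-even (inj₂ v+1≡u) eq = cyclic-successor-parity-≢ N-even v+1≡u (sym eq)


bipartiteSide : ∀ n → Fin (n + n) → Parity
bipartiteSide n i = if does (toℕ i <? n) then 0ℙ else 1ℙ

bipartiteSide-< : ∀ n {i} → toℕ i < n → bipartiteSide n i ≡ 0ℙ
bipartiteSide-< n {i} i<n = cong (if_then 0ℙ else 1ℙ) (dec-true (toℕ i <? n) i<n)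

bipartiteSide-≮ : ∀ n {i} → ¬ toℕ i < n → bipartiteSide n i ≡ 1ℙ
bipartiteSide-≮ n {i} i≮n = cong (if_then 0ℙ else 1ℙ) (dec-false (toℕ i <? n) i≮n)

completeBipartite-properColouring : ∀ n → ProperColouring (completeBipartite n) (bipartiteSide n)
completeBipartite-properColouring n (inj₁ (u<n , v≮n)) eq
  with trans (sym (bipartiteSide-< n u<n)) (trans eq (bipartiteSide-≮ n v≮n))
... | ()
completeBipartite-properColouring n (inj₂ (u≮n , v<n)) eq =
  completeBipartite-properColouring n (inj₁ (v<n , u≮n)) (sym eq)

mismatchSwap : ∀ {n} → Subset n → Subset n → Subset n × Subset n
mismatchSwap []            []            = [] , []
mismatchSwap (inside ∷ xs)  (inside ∷ ys)  = Product.map (inside ∷_) (inside ∷_) (mismatchSwap xs ys)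
mismatchSwap (outside ∷ xs) (outside ∷ ys) = Product.map (outside ∷_) (outside ∷_) (mismatchSwap xs ys)
mismatchSwap (inside ∷ xs)  (outside ∷ ys) = outside ∷ xs , inside ∷ ys
mismatchSwap (outside ∷ xs) (inside ∷ ys)  = inside ∷ xs , outside ∷ ys

mismatchSwap-involutive : ∀ {n} (xs ys : Subset n) → uncurry mismatchSwap (mismatchSwap xs ys) ≡ (xs , ys)
mismatchSwap-involutive []            []            = refl
mismatchSwap-involutive (inside ∷ xs)  (inside ∷ ys)  =
  cong (Product.map (inside ∷_) (inside ∷_)) (mismatchSwap-involutive xs ys)
mismatchSwap-involutive (outside ∷ xs) (outside ∷ ys) =
  cong (Product.map (outside ∷_) (outside ∷_)) (mismatchSwap-involutive xs ys)
mismatchSwap-involutive (inside ∷ xs)  (outside ∷ ys) = refl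
mismatchSwap-involutive (outside ∷ xs) (inside ∷ ys)  = refl

∣mismatchSwap∣ : ∀ {n} (xs ys : Subset n) →
                 ∣ proj₁ (mismatchSwap xs ys) ∣ + ∣ proj₂ (mismatchSwap xs ys) ∣ ≡ ∣ xs ∣ + ∣ ys ∣
∣mismatchSwap∣ []            []            = refl
∣mismatchSwap∣ (inside ∷ xs)  (inside ∷ ys)  = begin
  suc (∣ xs′ ∣ + suc ∣ ys′ ∣)   ≡⟨ cong suc (+-suc ∣ xs′ ∣ ∣ ys′ ∣) ⟩
  suc (suc (∣ xs′ ∣ + ∣ ys′ ∣)) ≡⟨ cong (2 +_) (∣mismatchSwap∣ xs ys) ⟩
  suc (suc (∣ xs ∣ + ∣ ys ∣))   ≡⟨ cong suc (+-suc ∣ xs ∣ ∣ ys ∣) ⟨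
  suc (∣ xs ∣ + suc ∣ ys ∣)     ∎
  where
  open ≡-Reasoning
  xs′ = proj₁ (mismatchSwap xs ys)
  ys′ = proj₂ (mismatchSwap xs ys)
∣mismatchSwap∣ (outside ∷ xs) (outside ∷ ys) = ∣mismatchSwap∣ xs ys
∣mismatchSwap∣ (inside ∷ xs)  (outside ∷ ys) = +-suc ∣ xs ∣ ∣ ys ∣
∣mismatchSwap∣ (outside ∷ xs) (inside ∷ ys)  = sym (+-suc ∣ xs ∣ ∣ ys ∣)

mismatchSwap-△ : ∀ {n} (xs ys : Subset n) → parity (∣ xs ∣ + ∣ ys ∣) ≡ 1ℙ →
                 ∃[ i ] (xs △ proj₁ (mismatchSwap xs ys) ≡ ⁅ i ⁆ ×
                         ys △ proj₂ (mismatchSwap xs ys) ≡ ⁅ i ⁆)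
mismatchSwap-△ [] [] ()
mismatchSwap-△ (inside ∷ xs) (inside ∷ ys) odd
  with i , xs△ , ys△ ← mismatchSwap-△ xs ys (trans (cong parity (sym (+-suc (suc ∣ xs ∣) ∣ ys ∣))) odd)
  = suc i , cong (outside ∷_) xs△ , cong (outside ∷_) ys△
mismatchSwap-△ (outside ∷ xs) (outside ∷ ys) odd
  with i , xs△ , ys△ ← mismatchSwap-△ xs ys odd
  = suc i , cong (outside ∷_) xs△ , cong (outside ∷_) ys△
mismatchSwap-△ (inside ∷ xs)  (outside ∷ ys) _ =
  zero , cong (inside ∷_) (△-self xs) , cong (inside ∷_) (△-self ys)
mismatchSwap-△ (outside ∷ xs) (inside ∷ ys)  _ =
  zero , cong (inside ∷_) (△-self xs) , cong (inside ∷_) (△-self ys)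

∣++∣ : ∀ {n m} (xs : Subset n) (ys : Subset m) → ∣ xs ++ ys ∣ ≡ ∣ xs ∣ + ∣ ys ∣
∣++∣ []            ys = refl
∣++∣ (inside ∷ xs)  ys = cong suc (∣++∣ xs ys)
∣++∣ (outside ∷ xs) ys = ∣++∣ xs ys

⊥++⊥ : ∀ {n m} → ⊥ {n} ++ ⊥ {m} ≡ ⊥
⊥++⊥ {zero}  = refl
⊥++⊥ {suc n} = cong (outside ∷_) (⊥++⊥ {n})

⁅↑ˡ⁆ : ∀ {n} m (i : Fin n) → ⁅ i ↑ˡ m ⁆ ≡ ⁅ i ⁆ ++ ⊥ {m}
⁅↑ˡ⁆ {suc n} m zero    = cong (inside ∷_) (sym (⊥++⊥ {n} {m}))
⁅↑ˡ⁆         m (suc i) = cong (outside ∷_) (⁅↑ˡ⁆ m i)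

⁅↑ʳ⁆ : ∀ {m} n (i : Fin m) → ⁅ n ↑ʳ i ⁆ ≡ ⊥ {n} ++ ⁅ i ⁆
⁅↑ʳ⁆ zero    i = refl
⁅↑ʳ⁆ (suc n) i = cong (outside ∷_) (⁅↑ʳ⁆ n i)

bipartiteSwitch : ∀ n → Subset (n + n) → Subset (n + n)
bipartiteSwitch n A = uncurry _++_ (mismatchSwap (take n A) (drop n A))

bipartiteSwitch-++ : ∀ {n} (xs ys : Subset n) → bipartiteSwitch n (xs ++ ys) ≡ uncurry _++_ (mismatchSwap xs ys)
bipartiteSwitch-++ {n} xs ys =
  let take≡xs , drop≡ys = ++-injective (take n (xs ++ ys)) xs (take++drop≡id n (xs ++ ys))
  in cong (uncurry _++_) (cong₂ mismatchSwap take≡xs drop≡ys)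

++-elim : ∀ {n} (P : Subset (n + n) → Set) → (∀ xs ys → P (xs ++ ys)) → ∀ A → P A
++-elim {n} P P++ A = subst P (take++drop≡id n A) (P++ (take n A) (drop n A))

bipartiteSwitch-involutive : ∀ n A → bipartiteSwitch n (bipartiteSwitch n A) ≡ A
bipartiteSwitch-involutive n = ++-elim {n} _ λ xs ys → begin
  bipartiteSwitch n (bipartiteSwitch n (xs ++ ys))  ≡⟨ cong (bipartiteSwitch n) (bipartiteSwitch-++ xs ys) ⟩
  bipartiteSwitch n (uncurry _++_ (mismatchSwap xs ys))
    ≡⟨ bipartiteSwitch-++ (proj₁ (mismatchSwap xs ys)) (proj₂ (mismatchSwap xs ys)) ⟩
  uncurry _++_ (uncurry mismatchSwap (mismatchSwap xs ys))  ≡⟨ cong (uncurry _++_) (mismatchSwap-involutive xs ys) ⟩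
  xs ++ ys                                            ∎
  where open ≡-Reasoning

∣bipartiteSwitch∣ : ∀ n A → ∣ bipartiteSwitch n A ∣ ≡ ∣ A ∣
∣bipartiteSwitch∣ n = ++-elim {n} _ λ xs ys → begin
  ∣ bipartiteSwitch n (xs ++ ys) ∣                          ≡⟨ cong ∣_∣ (bipartiteSwitch-++ xs ys) ⟩
  ∣ proj₁ (mismatchSwap xs ys) ++ proj₂ (mismatchSwap xs ys) ∣ ≡⟨ ∣++∣ (proj₁ (mismatchSwap xs ys)) _ ⟩
  ∣ proj₁ (mismatchSwap xs ys) ∣ + ∣ proj₂ (mismatchSwap xs ys) ∣ ≡⟨ ∣mismatchSwap∣ xs ys ⟩
  ∣ xs ∣ + ∣ ys ∣                                            ≡⟨ ∣++∣ xs ys ⟨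
  ∣ xs ++ ys ∣                                              ∎
  where open ≡-Reasoning

bipartiteSwitch-adjacent : ∀ n A → parity ∣ A ∣ ≡ 1ℙ → TokenAdj (completeBipartite n) A (bipartiteSwitch n A)
bipartiteSwitch-adjacent n = ++-elim {n} _ λ xs ys odd →
  let i , xs△ , ys△ = mismatchSwap-△ xs ys (trans (cong parity (sym (∣++∣ xs ys))) odd)
      xs′ = proj₁ (mismatchSwap xs ys)
      ys′ = proj₂ (mismatchSwap xs ys)
  in i ↑ˡ n , n ↑ʳ i , inj₁ (left i , right i) , (begin
    (xs ++ ys) △ bipartiteSwitch n (xs ++ ys)   ≡⟨ cong ((xs ++ ys) △_) (bipartiteSwitch-++ xs ys) ⟩
    (xs ++ ys) △ (xs′ ++ ys′)                   ≡⟨ zipWith-++ _xor_ xs ys xs′ ys′ ⟩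
    (xs △ xs′) ++ (ys △ ys′)                    ≡⟨ cong₂ _++_ xs△ ys△ ⟩
    ⁅ i ⁆ ++ ⁅ i ⁆                              ≡⟨ cong₂ _++_ (∪-identityʳ ⁅ i ⁆) (∪-identityˡ ⁅ i ⁆) ⟨
    (⁅ i ⁆ ∪ ⊥) ++ (⊥ ∪ ⁅ i ⁆)                  ≡⟨ zipWith-++ _∨_ ⁅ i ⁆ ⊥ ⊥ ⁅ i ⁆ ⟨
    (⁅ i ⁆ ++ ⊥) ∪ (⊥ ++ ⁅ i ⁆)                 ≡⟨ cong₂ _∪_ (⁅↑ˡ⁆ n i) (⁅↑ʳ⁆ n i) ⟨
    ⁅ i ↑ˡ n ⁆ ∪ ⁅ n ↑ʳ i ⁆                     ∎)
  where
  open ≡-Reasoning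
  left : ∀ i → toℕ (i ↑ˡ n) < n
  left i = subst (_< n) (sym (toℕ-↑ˡ i n)) (toℕ<n i)
  right : ∀ i → ¬ toℕ (n ↑ʳ i) < n
  right i n+i<n = <-irrefl refl (<-≤-trans n+i<n (subst (n ≤_) (sym (toℕ-↑ʳ n i)) (m≤m+n n (toℕ i))))

completeBipartite-tokenSwitch : ∀ n → TokenSwitch (completeBipartite n)
completeBipartite-tokenSwitch n = record
  { switch            = bipartiteSwitch n
  ; switch-involutive = bipartiteSwitch-involutive n
  ; ∣switch∣          = ∣bipartiteSwitch∣ n
  ; switch-adjacent   = bipartiteSwitch-adjacent n
  }

%2≡1⇒parity≡1ℙ : ∀ k → k % 2 ≡ 1 → parity k ≡ 1ℙ
%2≡1⇒parity≡1ℙ (suc zero)    _ = refl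
%2≡1⇒parity≡1ℙ (suc (suc k)) k%2≡1 = %2≡1⇒parity≡1ℙ k k%2≡1

-- Only the oddness of k and 1 ≤ n (to unfold cycle (n + n)) are used; for k > 2n both sides are 0.
corollary3p7 : (n k : ℕ) → 1 ≤ n → k % 2 ≡ 1 → 1 ≤ k → k ≤ 2 * n ∸ 1 →
    IndependenceNumberTokenGraph (path (n + n)) k (((n + n) C k) / 2) ×
    (2 ≤ n → IndependenceNumberTokenGraph (cycle (n + n)) k (((n + n) C k) / 2)) ×
    IndependenceNumberTokenGraph (completeBipartite n) k (((n + n) C k) / 2)
corollary3p7 n@(suc _) k _ k%2≡1 _ _ =
  independenceNumber≡half (path-properColouring (n + n)) (path-tokenSwitch (parity[n+n]≡0ℙ n)) k-odd ,
  (λ _ → independenceNumber≡half (cycle-properColouring (parity[n+n]≡0ℙ n))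
                                 (cycle-tokenSwitch (parity[n+n]≡0ℙ n)) k-odd) ,
  independenceNumber≡half (completeBipartite-properColouring n) (completeBipartite-tokenSwitch n) k-odd
  where
  k-odd : parity k ≡ 1ℙ
  k-odd = %2≡1⇒parity≡1ℙ k k%2≡1
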